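{- Let $V_{\mathsf{query}}$ and $U_{\mathsf{query}}$ be two embeddable query generation algorithms (with respect to the same distribution $\mathcal D$ over $\{0,1\}^n$). Then the algorithm $T_{\mathsf{query}}(r_1,r_2)$ that outputs the concatenation of $V_{\mathsf{query}}(r_1)$ and $U_{\mathsf{query}}(r_2)$, for independent randomness $r_1,r_2$, is also embeddable.
   Context: Let $\mathcal D$ be a distribution over $\{0,1\}^n$ and let $V_{\mathsf{query}}$ be an algorithm that, given randomness $r$, returns a sequence of $Q$ queries $y_1,\dots,y_Q\in\{0,1\}^n$. $V_{\mathsf{query}}$ is embeddable (a random query from $\mathcal D$ can be embedded into it) if there is an algorithm $\hat V_{\mathsf{query}}$ that takes as input $w\sim\mathcal D$ and randomness $r'$ and outputs $\hat y_1,\dots,\hat y_Q\in\{0,1\}^n$ such that: (1) there exists $i\in[Q]$ with $\hat y_i=w$; (2) for every $\hat y_1,\dots,\hat y_Q$ generated by $V_{\mathsf{query}}$ with nonzero probability, $\Pr_{r'}[\hat y_i=w\mid \hat V_{\mathsf{query}}(w;r')\text{ outputs }\hat y_1,\dots,\hat y_Q]=1/Q$ (the index into which $w$ is embedded is uniform, probability over $r'$ and $w\sim\mathcal D$); (3) for all $\hat y_1,\dots,\hat y_Q$, $\Pr[\hat V_{\mathsf{query}}(w;r')\text{ outputs }\hat y_1,\dots,\hat y_Q]=\Pr_r[V_{\mathsf{query}}(r)\text{ outputs }\hat y_1,\dots,\hat y_Q]$.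
   Formalization: The distribution $\mathcal D$ over $\{0,1\}^n$ is taken with rational point masses rather than arbitrary real ones. -}

module Defs where

open import Data.Nat using (ℕ; zero; suc)
open import Data.Integer using (+_)
open import Data.Bool using (Bool; true; false; if_then_else_; _∧_)
import Data.Bool as Bool
open import Data.Fin using (Fin; remQuot)
import Data.Fin as Fin
open import Data.Vec using (Vec; []; _∷_; lookup; _++_)
open import Data.Vec.Properties using (≡-dec)
open import Data.List using (List; []; _∷_; map; concatMap; foldr; allFin)
open import Data.Rational using (ℚ; 0ℚ; 1ℚ; _+_; _*_; _/_; _<_; _≤_)
open import Data.Product using (_×_; _,_; proj₁; proj₂)
open import Relation.Nullary.Decidable using (⌊_⌋)
open import Relation.Binary.PropositionalEquality using (_≡_)

Str : ℕ → Set
Str n = Vec Bool n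

allStr : (n : ℕ) → List (Str n)
allStr zero = [] ∷ []
allStr (suc n) = concatMap (λ v → (false ∷ v) ∷ (true ∷ v) ∷ []) (allStr n)

sumList : {A : Set} → List A → (A → ℚ) → ℚ
sumList xs f = foldr (λ x acc → f x + acc) 0ℚ xs

sumFin : (k : ℕ) → (Fin k → ℚ) → ℚ
sumFin k f = sumList (allFin k) f

sumStr : (n : ℕ) → (Str n → ℚ) → ℚ
sumStr n f = sumList (allStr n) f

𝟙 : Bool → ℚ
𝟙 b = if b then 1ℚ else 0ℚ

eqQ : {n Q : ℕ} → Vec (Str n) Q → Vec (Str n) Q → Bool
eqQ xs ys = ⌊ ≡-dec (≡-dec Bool._≟_) xs ys ⌋

eqFin : {Q : ℕ} → Fin Q → Fin Q → Bool
eqFin i j = ⌊ i Fin.≟ j ⌋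

record Dist (n : ℕ) : Set where
  field
    weight : Str n → ℚ
    nonneg : ∀ w → 0ℚ ≤ weight w
    total  : sumStr n weight ≡ 1ℚ
open Dist public

-- A query generation algorithm producing Q queries from uniform
-- randomness r ∈ Fin (suc R) (a nonempty finite randomness space).
record QueryGen (n Q : ℕ) : Set where
  field
    R   : ℕ
    gen : Fin (suc R) → Vec (Str n) Q
open QueryGen public

PrGen : {n Q : ℕ} → QueryGen n Q → Vec (Str n) Q → ℚ
PrGen V ys = sumFin (suc (R V)) (λ r → 𝟙 (eqQ (gen V r) ys)) * (+ 1 / suc (R V))

-- Pr_{w ∼ D, r'} [ E(w, output of V̂(w; r')) ], where V̂ outputs the
-- embedding index together with the query sequence.
PrEmb : {n Q : ℕ} → Dist n → (R' : ℕ)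
      → (Str n → Fin (suc R') → Fin Q × Vec (Str n) Q)
      → (Str n → Fin Q → Vec (Str n) Q → Bool) → ℚ
PrEmb {n} D R' emb E =
  sumStr n (λ w → weight D w *
    (sumFin (suc R') (λ r' → 𝟙 (E w (proj₁ (emb w r')) (proj₂ (emb w r'))))
      * (+ 1 / suc R')))

-- V is embeddable w.r.t. D: there is an algorithm V̂ taking w ∼ D and
-- randomness r' and outputting ŷ₁..ŷ_Q together with the index i into which
-- w is embedded such that
--  (1) ŷ_i = w,
--  (2) [stated as Q·Pr[i=j ∧ out=ŷ] = Pr[out=ŷ]] conditioned on the output ŷ (with ŷ generated by V with nonzero
--      probability), the index i is uniform over [Q],
--  (3) the output ŷ has exactly the same distribution as V's output.
record Embeddable {n Q : ℕ} (D : Dist n) (V : QueryGen n Q) : Set where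
  field
    R'  : ℕ
    emb : Str n → Fin (suc R') → Fin Q × Vec (Str n) Q
    embeds : ∀ w r' → 0ℚ < weight D w →
      lookup (proj₂ (emb w r')) (proj₁ (emb w r')) ≡ w
    uniformIndex : ∀ ys → 0ℚ < PrGen V ys → ∀ j →
      (+ Q / 1) * PrEmb D R' emb (λ _ i ys' → eqFin i j ∧ eqQ ys' ys)
        ≡ PrEmb D R' emb (λ _ _ ys' → eqQ ys' ys)
    sameDist : ∀ ys →
      PrEmb D R' emb (λ _ _ ys' → eqQ ys' ys) ≡ PrGen V ys

-- T(r₁, r₂) = V(r₁) ++ U(r₂), with independent uniform r₁, r₂
-- (randomness space Fin (suc R₁ * suc R₂) ≅ Fin (suc R₁) × Fin (suc R₂)).
concatGen : {n Q₁ Q₂ : ℕ} → QueryGen n Q₁ → QueryGen n Q₂ → QueryGen n (Q₁ Data.Nat.+ Q₂)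
concatGen V U = record
  { R = R U Data.Nat.+ R V Data.Nat.* suc (R U)
  ; gen = λ r → gen V (proj₁ (remQuot {suc (R V)} (suc (R U)) r))
             ++ gen U (proj₂ (remQuot {suc (R V)} (suc (R U)) r))
  }

{-# OPTIONS --safe #-}

-- Given w, the embedding for the concatenation draws an index block: the first Q₁ positions
-- with probability Q₁/(Q₁+Q₂), the last Q₂ otherwise.  In the first case it embeds w into
-- V's queries with V̂ and appends an independent run of U; in the second it prepends an
-- independent run of V to Û(w).  By independence each branch outputs y₁ ++ y₂ with
-- probability Pr[V = y₁]·Pr[U = y₂], hence so does the mixture.  Given that output, the
-- index lies in a block with probability proportional to its size and, by uniformity for
-- V̂ resp. Û, is uniform inside it, hence uniform over all Q₁ + Q₂ positions.
module Submission where

open import Defs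
open import Algebra.Bundles using (CommutativeMonoid; CommutativeRing)
open import Data.Bool as Bool using (Bool; true; false; _∧_)
open import Data.Fin as Fin using (Fin; _↑ˡ_; _↑ʳ_; splitAt; remQuot; combine; join)
open import Data.Fin.Properties
  using (¬Fin0; splitAt-↑ˡ; splitAt-↑ʳ; remQuot-combine; join-splitAt; ↑ˡ-injective; ↑ʳ-injective)
import Data.Integer as ℤ
import Data.Integer.Properties as ℤ
open import Data.List as List using (List; tabulate)
open import Data.List.Properties using (tabulate-lookup)
open import Data.Nat as ℕ using (ℕ; zero; suc)
open import Data.Product using (_×_; _,_; proj₁; proj₂; uncurry)
open import Data.Rational using (ℚ; 0ℚ; 1ℚ; _+_; _*_; _/_; _<_; _≤_; toℚᵘ; NonNegative; nonNegative)
open import Data.Rational.Properties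
open import Data.Rational.Solver using (module +-*-Solver)
import Data.Rational.Unnormalised as ℚᵘ
import Data.Rational.Unnormalised.Properties as ℚᵘ
open import Data.Sum using (_⊎_; inj₁; inj₂; [_,_]′)
open import Data.Vec as Vec using (Vec; _++_; lookup)
open import Data.Vec.Properties using (≡-dec; ++-injective; lookup-++ˡ; lookup-++ʳ)
open import Function using (_∘_; id; _⇔_; mk⇔)
open import Relation.Binary.Definitions using (DecidableEquality; tri<; tri≈; tri>)
open import Relation.Binary.PropositionalEquality
open import Relation.Nullary using (Dec; ¬_; _×-dec_; contradiction)
open import Relation.Nullary.Decidable using (isYes; isYes≗does; does-⇔; dec-false)

open import Algebra.Properties.CommutativeSemigroup (CommutativeMonoid.commutativeSemigroup *-1-commutativeMonoid)
  using (x∙yz≈y∙xz; x∙yz≈xz∙y; x∙yz≈yx∙z; xy∙z≈xz∙y)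
open import Algebra.Properties.Semiring.Sum (CommutativeRing.semiring +-*-commutativeRing)
  using (sum; sum-cong-≗; ∑-distrib-+; *-distribˡ-sum; *-distribʳ-sum)
open +-*-Solver using (solve; _:+_; _:*_; _:=_; con)

isYes-⇔ : ∀ {A B : Set} → A ⇔ B → (a? : Dec A) (b? : Dec B) → isYes a? ≡ isYes b?
isYes-⇔ A⇔B a? b? = trans (isYes≗does a?) (trans (does-⇔ A⇔B a? b?) (sym (isYes≗does b?)))

isYes-× : ∀ {A B : Set} (a? : Dec A) (b? : Dec B) → isYes (a? ×-dec b?) ≡ isYes a? ∧ isYes b?
isYes-× a? b? = trans (isYes≗does (a? ×-dec b?)) (sym (cong₂ _∧_ (isYes≗does a?) (isYes≗does b?)))

isYes-¬ : ∀ {A : Set} → ¬ A → (a? : Dec A) → isYes a? ≡ false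
isYes-¬ ¬a a? = trans (isYes≗does a?) (dec-false a? ¬a)

eqQ-++ : ∀ {n m k} (xs xs′ : Vec (Str n) m) (ys ys′ : Vec (Str n) k) →
         eqQ (xs ++ ys) (xs′ ++ ys′) ≡ eqQ xs xs′ ∧ eqQ ys ys′
eqQ-++ xs xs′ ys ys′ = trans
  (isYes-⇔ (mk⇔ (++-injective xs xs′) (uncurry (cong₂ _++_)))
           ((xs ++ ys) ≟ᵛ (xs′ ++ ys′)) (xs ≟ᵛ xs′ ×-dec ys ≟ᵛ ys′))
  (isYes-× (xs ≟ᵛ xs′) (ys ≟ᵛ ys′))
  where
  _≟ᵛ_ : ∀ {n m} → DecidableEquality (Vec (Str n) m)
  _≟ᵛ_ = ≡-dec (≡-dec Bool._≟_)

eqFin-↑ˡ : ∀ {m} n (i j : Fin m) → eqFin (i ↑ˡ n) (j ↑ˡ n) ≡ eqFin i j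
eqFin-↑ˡ n i j = isYes-⇔ (mk⇔ (↑ˡ-injective n i j) (cong (_↑ˡ n))) (i ↑ˡ n Fin.≟ j ↑ˡ n) (i Fin.≟ j)

eqFin-↑ʳ : ∀ m {n} (i j : Fin n) → eqFin (m ↑ʳ i) (m ↑ʳ j) ≡ eqFin i j
eqFin-↑ʳ m i j = isYes-⇔ (mk⇔ (↑ʳ-injective m i j) (cong (m ↑ʳ_))) (m ↑ʳ i Fin.≟ m ↑ʳ j) (i Fin.≟ j)

↑ˡ≢↑ʳ : ∀ {m n} (i : Fin m) (j : Fin n) → i ↑ˡ n ≢ m ↑ʳ j
↑ˡ≢↑ʳ {m} {n} i j eq with () ← trans (sym (splitAt-↑ˡ m i n)) (trans (cong (splitAt m) eq) (splitAt-↑ʳ m n j))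

eqFin-↑ˡ-↑ʳ : ∀ {m n} (i : Fin m) (j : Fin n) → eqFin (i ↑ˡ n) (m ↑ʳ j) ≡ false
eqFin-↑ˡ-↑ʳ {m} {n} i j = isYes-¬ (↑ˡ≢↑ʳ i j) (i ↑ˡ n Fin.≟ m ↑ʳ j)

eqFin-↑ʳ-↑ˡ : ∀ {m n} (j : Fin n) (i : Fin m) → eqFin (m ↑ʳ j) (i ↑ˡ n) ≡ false
eqFin-↑ʳ-↑ˡ {m} {n} j i = isYes-¬ (≢-sym (↑ˡ≢↑ʳ i j)) (m ↑ʳ j Fin.≟ i ↑ˡ n)

𝟙-∧ : ∀ a b → 𝟙 (a ∧ b) ≡ 𝟙 a * 𝟙 b
𝟙-∧ true  b = sym (*-identityˡ (𝟙 b))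
𝟙-∧ false b = sym (*-zeroˡ (𝟙 b))

𝟙-nonNeg : ∀ b → 0ℚ ≤ 𝟙 b
𝟙-nonNeg true  = nonNegative⁻¹ 1ℚ
𝟙-nonNeg false = ≤-refl

𝟙-eqQ-++ : ∀ {n m k} (xs xs′ : Vec (Str n) m) (ys ys′ : Vec (Str n) k) →
           𝟙 (eqQ (xs ++ ys) (xs′ ++ ys′)) ≡ 𝟙 (eqQ xs xs′) * 𝟙 (eqQ ys ys′)
𝟙-eqQ-++ xs xs′ ys ys′ = trans (cong 𝟙 (eqQ-++ xs xs′ ys ys′)) (𝟙-∧ (eqQ xs xs′) (eqQ ys ys′))

toℚ : ℕ → ℚ
toℚ k = ℤ.+ k / 1

1/[1+_] : ℕ → ℚ
1/[1+ k ] = ℤ.+ 1 / suc k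

toℚᵘ-/ : ∀ i d → toℚᵘ (i / suc d) ℚᵘ.≃ ℚᵘ.mkℚᵘ i d
toℚᵘ-/ i d = toℚᵘ-fromℚᵘ (ℚᵘ.mkℚᵘ i d)

toℚ-+ : ∀ m n → toℚ (m ℕ.+ n) ≡ toℚ m + toℚ n
toℚ-+ m n = toℚᵘ-injective (begin-equality
  toℚᵘ (toℚ (m ℕ.+ n))                        ≃⟨ toℚᵘ-/ (ℤ.+ (m ℕ.+ n)) 0 ⟩
  ℚᵘ.mkℚᵘ (ℤ.+ (m ℕ.+ n)) 0                   ≃⟨ ℚᵘ.*≡* (cong (ℤ._* ℤ.+ 1) m+n≡m*1+n*1) ⟩
  ℚᵘ.mkℚᵘ (ℤ.+ m) 0 ℚᵘ.+ ℚᵘ.mkℚᵘ (ℤ.+ n) 0    ≃⟨ ℚᵘ.+-cong (toℚᵘ-/ (ℤ.+ m) 0) (toℚᵘ-/ (ℤ.+ n) 0) ⟨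
  toℚᵘ (toℚ m) ℚᵘ.+ toℚᵘ (toℚ n)              ≃⟨ toℚᵘ-homo-+ (toℚ m) (toℚ n) ⟨
  toℚᵘ (toℚ m + toℚ n)                        ∎)
  where
  open ℚᵘ.≤-Reasoning
  m+n≡m*1+n*1 : ℤ.+ (m ℕ.+ n) ≡ ℤ.+ m ℤ.* ℤ.+ 1 ℤ.+ ℤ.+ n ℤ.* ℤ.+ 1
  m+n≡m*1+n*1 = sym (cong₂ ℤ._+_ (ℤ.*-identityʳ (ℤ.+ m)) (ℤ.*-identityʳ (ℤ.+ n)))

1/[1+]-inverseʳ : ∀ k → toℚ (suc k) * 1/[1+ k ] ≡ 1ℚ
1/[1+]-inverseʳ k = toℚᵘ-injective (begin-equality
  toℚᵘ (toℚ (suc k) * 1/[1+ k ])                    ≃⟨ toℚᵘ-homo-* (toℚ (suc k)) 1/[1+ k ] ⟩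
  toℚᵘ (toℚ (suc k)) ℚᵘ.* toℚᵘ 1/[1+ k ]            ≃⟨ ℚᵘ.*-cong (toℚᵘ-/ (ℤ.+ suc k) 0) (toℚᵘ-/ (ℤ.+ 1) k) ⟩
  ℚᵘ.mkℚᵘ (ℤ.+ suc k) 0 ℚᵘ.* ℚᵘ.mkℚᵘ (ℤ.+ 1) k      ≃⟨ ℚᵘ.*-inverseʳ (ℚᵘ.mkℚᵘ (ℤ.+ suc k) 0) ⟩
  ℚᵘ.1ℚᵘ                                            ∎)
  where open ℚᵘ.≤-Reasoning

toℚ-cancelˡ : ∀ k {x y} → toℚ (suc k) * x ≡ toℚ (suc k) * y → x ≡ y
toℚ-cancelˡ k {x} {y} eq = trans (sym (undo x)) (trans (cong (1/[1+ k ] *_) eq) (undo y))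
  where
  undo : ∀ z → 1/[1+ k ] * (toℚ (suc k) * z) ≡ z
  undo z = begin
    1/[1+ k ] * (toℚ (suc k) * z)    ≡⟨ x∙yz≈yx∙z 1/[1+ k ] (toℚ (suc k)) z ⟩
    toℚ (suc k) * 1/[1+ k ] * z      ≡⟨ cong (_* z) (1/[1+]-inverseʳ k) ⟩
    1ℚ * z                           ≡⟨ *-identityˡ z ⟩
    z                                ∎
    where open ≡-Reasoning

*-positiveˡ : ∀ {p q} → 0ℚ ≤ p → 0ℚ < p * q → 0ℚ < p
*-positiveˡ {p} {q} 0≤p 0<pq with <-cmp 0ℚ p
... | tri< 0<p _ _ = 0<p
... | tri≈ _ refl _ = contradiction (sym (*-zeroˡ q)) (<⇒≢ 0<pq)
... | tri> _ _ p<0 = contradiction (≤-<-trans 0≤p p<0) (<-irrefl refl)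

*-positiveʳ : ∀ {p q} → 0ℚ ≤ q → 0ℚ < p * q → 0ℚ < q
*-positiveʳ {p} {q} 0≤q 0<pq = *-positiveˡ 0≤q (subst (0ℚ <_) (*-comm p q) 0<pq)

-- Fin (suc (m ⊗ n)) is definitionally Fin (suc m * suc n), the randomness space of concatGen.
_⊗_ : ℕ → ℕ → ℕ
m ⊗ n = n ℕ.+ m ℕ.* suc n

1/[1+]-⊗ : ∀ m n → 1/[1+ m ⊗ n ] ≡ 1/[1+ m ] * 1/[1+ n ]
1/[1+]-⊗ m n = toℚᵘ-injective (begin-equality
  toℚᵘ 1/[1+ m ⊗ n ]                    ≃⟨ toℚᵘ-/ (ℤ.+ 1) (m ⊗ n) ⟩
  ℚᵘ.mkℚᵘ (ℤ.+ 1) (m ⊗ n)               ≃⟨ ℚᵘ.*-cong (toℚᵘ-/ (ℤ.+ 1) m) (toℚᵘ-/ (ℤ.+ 1) n) ⟨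
  toℚᵘ 1/[1+ m ] ℚᵘ.* toℚᵘ 1/[1+ n ]    ≃⟨ toℚᵘ-homo-* 1/[1+ m ] 1/[1+ n ] ⟨
  toℚᵘ (1/[1+ m ] * 1/[1+ n ])          ∎)
  where open ℚᵘ.≤-Reasoning

pair : ∀ {m n} → Fin (suc (m ⊗ n)) → Fin (suc m) × Fin (suc n)
pair {m} {n} = remQuot {suc m} (suc n)

sumList-tabulate : ∀ {A : Set} {k} (g : Fin k → A) (f : A → ℚ) → sumList (tabulate g) f ≡ sum (f ∘ g)
sumList-tabulate {k = zero}  g f = refl
sumList-tabulate {k = suc k} g f = cong (f (g Fin.zero) +_) (sumList-tabulate (g ∘ Fin.suc) f)

sumList≡sum : ∀ {A : Set} (xs : List A) (f : A → ℚ) → sumList xs f ≡ sum (f ∘ List.lookup xs)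
sumList≡sum xs f = trans (cong (λ ys → sumList ys f) (sym (tabulate-lookup xs))) (sumList-tabulate (List.lookup xs) f)

sumFin≡sum : ∀ k (f : Fin k → ℚ) → sumFin k f ≡ sum f
sumFin≡sum k = sumList-tabulate id

sum-const : ∀ k c → sum {k} (λ _ → c) ≡ toℚ k * c
sum-const zero    c = sym (*-zeroˡ c)
sum-const (suc k) c = begin
  c + sum {k} (λ _ → c)    ≡⟨ cong₂ _+_ (sym (*-identityˡ c)) (sum-const k c) ⟩
  1ℚ * c + toℚ k * c       ≡⟨ *-distribʳ-+ c 1ℚ (toℚ k) ⟨
  (1ℚ + toℚ k) * c         ≡⟨ cong (_* c) (toℚ-+ 1 k) ⟨
  toℚ (suc k) * c          ∎
  where open ≡-Reasoning

sum-↑ : ∀ m {n} (f : Fin (m ℕ.+ n) → ℚ) → sum f ≡ sum (f ∘ (_↑ˡ n)) + sum (f ∘ (m ↑ʳ_))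
sum-↑ zero    f = sym (+-identityˡ (sum f))
sum-↑ (suc m) f = trans (cong (f Fin.zero +_) (sum-↑ m (f ∘ Fin.suc))) (sym (+-assoc (f Fin.zero) _ _))

sum-splitAt : ∀ m {n} (h : Fin m ⊎ Fin n → ℚ) → sum (h ∘ splitAt m) ≡ sum (h ∘ inj₁) + sum (h ∘ inj₂)
sum-splitAt m {n} h = trans (sum-↑ m (h ∘ splitAt m))
  (cong₂ _+_ (sum-cong-≗ {m} (λ i → cong h (splitAt-↑ˡ m i n))) (sum-cong-≗ {n} (cong h ∘ splitAt-↑ʳ m n)))

sum-combine : ∀ m {n} (f : Fin (m ℕ.* n) → ℚ) → sum f ≡ sum (λ (i : Fin m) → sum (λ (j : Fin n) → f (combine i j)))
sum-combine zero        f = refl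
sum-combine (suc m) {n} f = trans (sum-↑ n f) (cong (sum (f ∘ (_↑ˡ m ℕ.* n)) +_) (sum-combine m (f ∘ (n ↑ʳ_))))

sum-remQuot : ∀ m n (f : Fin m × Fin n → ℚ) → sum (f ∘ remQuot n) ≡ sum (λ i → sum (λ j → f (i , j)))
sum-remQuot m n f = trans (sum-combine m (f ∘ remQuot n))
  (sum-cong-≗ {m} λ i → sum-cong-≗ {n} λ j → cong f (remQuot-combine i j))

sum-nonNeg : ∀ {k} {f : Fin k → ℚ} → (∀ i → 0ℚ ≤ f i) → 0ℚ ≤ sum f
sum-nonNeg {zero}  f≥0 = ≤-refl
sum-nonNeg {suc k} f≥0 = +-mono-≤ (f≥0 Fin.zero) (sum-nonNeg (f≥0 ∘ Fin.suc))

avg : (k : ℕ) → (Fin (suc k) → ℚ) → ℚ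
avg k f = sumFin (suc k) f * 1/[1+ k ]

avg≡sum : ∀ k (f : Fin (suc k) → ℚ) → avg k f ≡ sum f * 1/[1+ k ]
avg≡sum k f = cong (_* 1/[1+ k ]) (sumFin≡sum (suc k) f)

toℚ*avg : ∀ k (f : Fin (suc k) → ℚ) → toℚ (suc k) * avg k f ≡ sum f
toℚ*avg k f = begin
  toℚ (suc k) * avg k f                  ≡⟨ cong (toℚ (suc k) *_) (avg≡sum k f) ⟩
  toℚ (suc k) * (sum f * 1/[1+ k ])      ≡⟨ x∙yz≈y∙xz (toℚ (suc k)) (sum f) 1/[1+ k ] ⟩
  sum f * (toℚ (suc k) * 1/[1+ k ])      ≡⟨ cong (sum f *_) (1/[1+]-inverseʳ k) ⟩
  sum f * 1ℚ                             ≡⟨ *-identityʳ (sum f) ⟩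
  sum f                                  ∎
  where open ≡-Reasoning

avg-cong : ∀ k {f g : Fin (suc k) → ℚ} → (∀ r → f r ≡ g r) → avg k f ≡ avg k g
avg-cong k {f} {g} f≗g = begin
  avg k f                ≡⟨ avg≡sum k f ⟩
  sum f * 1/[1+ k ]      ≡⟨ cong (_* 1/[1+ k ]) (sum-cong-≗ f≗g) ⟩
  sum g * 1/[1+ k ]      ≡⟨ avg≡sum k g ⟨
  avg k g                ∎
  where open ≡-Reasoning

avg-const : ∀ k c → avg k (λ _ → c) ≡ c
avg-const k c = begin
  avg k (λ _ → c)                    ≡⟨ avg≡sum k (λ _ → c) ⟩
  sum {suc k} (λ _ → c) * 1/[1+ k ]  ≡⟨ cong (_* 1/[1+ k ]) (sum-const (suc k) c) ⟩
  toℚ (suc k) * c * 1/[1+ k ]        ≡⟨ xy∙z≈xz∙y (toℚ (suc k)) c 1/[1+ k ] ⟩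
  toℚ (suc k) * 1/[1+ k ] * c        ≡⟨ cong (_* c) (1/[1+]-inverseʳ k) ⟩
  1ℚ * c                             ≡⟨ *-identityˡ c ⟩
  c                                  ∎
  where open ≡-Reasoning

avg-*ˡ : ∀ k c (f : Fin (suc k) → ℚ) → avg k (λ r → c * f r) ≡ c * avg k f
avg-*ˡ k c f = begin
  avg k (λ r → c * f r)        ≡⟨ avg≡sum k (λ r → c * f r) ⟩
  sum (λ r → c * f r) * 1/[1+ k ]  ≡⟨ cong (_* 1/[1+ k ]) (*-distribˡ-sum c f) ⟨
  c * sum f * 1/[1+ k ]        ≡⟨ *-assoc c (sum f) 1/[1+ k ] ⟩
  c * (sum f * 1/[1+ k ])      ≡⟨ cong (c *_) (avg≡sum k f) ⟨
  c * avg k f                  ∎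
  where open ≡-Reasoning

avg-*ʳ : ∀ k c (f : Fin (suc k) → ℚ) → avg k (λ r → f r * c) ≡ avg k f * c
avg-*ʳ k c f = trans (avg-cong k (λ r → *-comm (f r) c)) (trans (avg-*ˡ k c f) (*-comm c (avg k f)))

avg-pair : ∀ m n (f : Fin (suc m) × Fin (suc n) → ℚ) →
           avg (m ⊗ n) (f ∘ pair) ≡ avg m (λ i → avg n (λ j → f (i , j)))
avg-pair m n f = begin
  avg (m ⊗ n) (f ∘ pair)                              ≡⟨ avg≡sum (m ⊗ n) (f ∘ pair) ⟩
  sum (f ∘ pair) * 1/[1+ m ⊗ n ]                      ≡⟨ cong₂ _*_ (sum-remQuot (suc m) (suc n) f) (1/[1+]-⊗ m n) ⟩
  sum (λ i → sum (λ j → f (i , j))) * (1/[1+ m ] * 1/[1+ n ])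
    ≡⟨ x∙yz≈xz∙y (sum (λ i → sum (λ j → f (i , j)))) 1/[1+ m ] 1/[1+ n ] ⟩
  sum (λ i → sum (λ j → f (i , j))) * 1/[1+ n ] * 1/[1+ m ]
    ≡⟨ cong (_* 1/[1+ m ]) (*-distribʳ-sum 1/[1+ n ] (λ i → sum (λ j → f (i , j)))) ⟩
  sum (λ i → sum (λ j → f (i , j)) * 1/[1+ n ]) * 1/[1+ m ]
    ≡⟨ avg≡sum m (λ i → sum (λ j → f (i , j)) * 1/[1+ n ]) ⟨
  avg m (λ i → sum (λ j → f (i , j)) * 1/[1+ n ])     ≡⟨ avg-cong m (λ i → avg≡sum n (λ j → f (i , j))) ⟨
  avg m (λ i → avg n (λ j → f (i , j)))               ∎
  where open ≡-Reasoning

avg-pair-* : ∀ m n (f : Fin (suc m) → ℚ) (g : Fin (suc n) → ℚ) →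
             avg (m ⊗ n) (λ r → f (proj₁ (pair {m} {n} r)) * g (proj₂ (pair {m} {n} r))) ≡ avg m f * avg n g
avg-pair-* m n f g = begin
  avg (m ⊗ n) (λ r → f (proj₁ (pair {m} {n} r)) * g (proj₂ (pair {m} {n} r)))
    ≡⟨ avg-pair m n (λ (i , j) → f i * g j) ⟩
  avg m (λ i → avg n (λ j → f i * g j))                        ≡⟨ avg-cong m (λ i → avg-*ˡ n (f i) g) ⟩
  avg m (λ i → f i * avg n g)                                  ≡⟨ avg-*ʳ m (avg n g) f ⟩
  avg m f * avg n g                                            ∎
  where open ≡-Reasoning

avg-nonNeg : ∀ k {f : Fin (suc k) → ℚ} → (∀ r → 0ℚ ≤ f r) → 0ℚ ≤ avg k f
avg-nonNeg k {f} f≥0 = subst (0ℚ ≤_) (sym (avg≡sum k f)) (nonNegative⁻¹ (sum f * 1/[1+ k ]) {{sum*1/[1+k]-nonNeg}})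
  where
  sum*1/[1+k]-nonNeg : NonNegative (sum f * 1/[1+ k ])
  sum*1/[1+k]-nonNeg = nonNeg*nonNeg⇒nonNeg (sum f) {{nonNegative (sum-nonNeg f≥0)}} 1/[1+ k ] {{normalize-nonNeg 1 (suc k)}}

avg-pair-proj₁ : ∀ m n (f : Fin (suc m) → ℚ) → avg (m ⊗ n) (f ∘ proj₁ ∘ pair {m} {n}) ≡ avg m f
avg-pair-proj₁ m n f = trans (avg-pair m n (f ∘ proj₁)) (avg-cong m (λ i → avg-const n (f i)))

avg-pair-proj₂ : ∀ m n (f : Fin (suc n) → ℚ) → avg (m ⊗ n) (f ∘ proj₂ ∘ pair {m} {n}) ≡ avg n f
avg-pair-proj₂ m n f = trans (avg-pair m n (f ∘ proj₂)) (avg-const m (avg n f))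

select : ∀ {X A B : Set} {k₁ k₂} → (Fin (suc k₁) → X) → (Fin (suc k₂) → X) →
         A ⊎ B → Fin (suc (k₁ ⊗ k₂)) → X
select {k₁ = k₁} {k₂} f g (inj₁ _) s = f (proj₁ (pair {k₁} {k₂} s))
select {k₁ = k₁} {k₂} f g (inj₂ _) s = g (proj₂ (pair {k₁} {k₂} s))

mixture : ∀ {X : Set} p q {k₁ k₂} → (Fin (suc k₁) → X) → (Fin (suc k₂) → X) →
          Fin (suc ((p ℕ.+ q) ⊗ (k₁ ⊗ k₂))) → X
mixture p q f g r = let (c , s) = pair r in select f g (splitAt (suc p) {q} c) s

avg-mixture : ∀ {X : Set} p q {k₁ k₂} (h : X → ℚ) (f : Fin (suc k₁) → X) (g : Fin (suc k₂) → X) →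
              toℚ (suc p ℕ.+ q) * avg ((p ℕ.+ q) ⊗ (k₁ ⊗ k₂)) (h ∘ mixture p q f g)
                ≡ toℚ (suc p) * avg k₁ (h ∘ f) + toℚ q * avg k₂ (h ∘ g)
avg-mixture p q {k₁} {k₂} h f g = begin
  toℚ (suc p ℕ.+ q) * avg _ (h ∘ mixture p q f g)
    ≡⟨ cong (toℚ (suc p ℕ.+ q) *_) (avg-pair (p ℕ.+ q) (k₁ ⊗ k₂) (λ (c , s) → h (select f g (block c) s))) ⟩
  toℚ (suc p ℕ.+ q) * avg (p ℕ.+ q) (λ c → avg (k₁ ⊗ k₂) (h ∘ select f g (block c)))
    ≡⟨ cong (toℚ (suc p ℕ.+ q) *_) (avg-cong (p ℕ.+ q) (avg-select ∘ block)) ⟩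
  toℚ (suc p ℕ.+ q) * avg (p ℕ.+ q) (outcome ∘ block)
    ≡⟨ toℚ*avg (p ℕ.+ q) (outcome ∘ block) ⟩
  sum (outcome ∘ block)
    ≡⟨ sum-splitAt (suc p) outcome ⟩
  sum {suc p} (λ _ → x) + sum {q} (λ _ → y)
    ≡⟨ cong₂ _+_ (sum-const (suc p) x) (sum-const q y) ⟩
  toℚ (suc p) * x + toℚ q * y
    ∎
  where
  open ≡-Reasoning
  block : Fin (suc p ℕ.+ q) → Fin (suc p) ⊎ Fin q
  block = splitAt (suc p)
  x y : ℚ
  x = avg k₁ (h ∘ f)
  y = avg k₂ (h ∘ g)
  outcome : Fin (suc p) ⊎ Fin q → ℚ
  outcome = [ (λ _ → x) , (λ _ → y) ]′
  avg-select : ∀ b → avg (k₁ ⊗ k₂) (h ∘ select f g b) ≡ outcome b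
  avg-select (inj₁ _) = avg-pair-proj₁ k₁ k₂ (h ∘ f)
  avg-select (inj₂ _) = avg-pair-proj₂ k₁ k₂ (h ∘ g)

module _ {n : ℕ} (D : Dist n) where

  𝔼 : (Str n → ℚ) → ℚ
  𝔼 f = sumStr n (λ w → weight D w * f w)

  private
    str : Fin (List.length (allStr n)) → Str n
    str = List.lookup (allStr n)

    weighted : (Str n → ℚ) → Fin (List.length (allStr n)) → ℚ
    weighted f i = weight D (str i) * f (str i)

  𝔼≡sum : ∀ f → 𝔼 f ≡ sum (weighted f)
  𝔼≡sum f = sumList≡sum (allStr n) (λ w → weight D w * f w)

  𝔼-cong : ∀ {f g} → (∀ w → f w ≡ g w) → 𝔼 f ≡ 𝔼 g
  𝔼-cong {f} {g} f≗g = begin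
    𝔼 f               ≡⟨ 𝔼≡sum f ⟩
    sum (weighted f)  ≡⟨ sum-cong-≗ (λ i → cong (weight D (str i) *_) (f≗g (str i))) ⟩
    sum (weighted g)  ≡⟨ 𝔼≡sum g ⟨
    𝔼 g               ∎
    where open ≡-Reasoning

  𝔼-+ : ∀ f g → 𝔼 (λ w → f w + g w) ≡ 𝔼 f + 𝔼 g
  𝔼-+ f g = begin
    𝔼 (λ w → f w + g w)                          ≡⟨ 𝔼≡sum (λ w → f w + g w) ⟩
    sum (weighted (λ w → f w + g w))
      ≡⟨ sum-cong-≗ (λ i → *-distribˡ-+ (weight D (str i)) (f (str i)) (g (str i))) ⟩
    sum (λ i → weighted f i + weighted g i)      ≡⟨ ∑-distrib-+ (weighted f) (weighted g) ⟩
    sum (weighted f) + sum (weighted g)          ≡⟨ cong₂ _+_ (𝔼≡sum f) (𝔼≡sum g) ⟨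
    𝔼 f + 𝔼 g                                    ∎
    where open ≡-Reasoning

  𝔼-*ˡ : ∀ c f → 𝔼 (λ w → c * f w) ≡ c * 𝔼 f
  𝔼-*ˡ c f = begin
    𝔼 (λ w → c * f w)                  ≡⟨ 𝔼≡sum (λ w → c * f w) ⟩
    sum (weighted (λ w → c * f w))     ≡⟨ sum-cong-≗ (λ i → x∙yz≈y∙xz (weight D (str i)) c (f (str i))) ⟩
    sum (λ i → c * weighted f i)       ≡⟨ *-distribˡ-sum c (weighted f) ⟨
    c * sum (weighted f)               ≡⟨ cong (c *_) (𝔼≡sum f) ⟨
    c * 𝔼 f                            ∎
    where open ≡-Reasoning

  𝔼-*ʳ : ∀ c f → 𝔼 (λ w → f w * c) ≡ 𝔼 f * c
  𝔼-*ʳ c f = trans (𝔼-cong (λ w → *-comm (f w) c)) (trans (𝔼-*ˡ c f) (*-comm c (𝔼 f)))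

  𝔼-zero : 𝔼 (λ _ → 0ℚ) ≡ 0ℚ
  𝔼-zero = begin
    𝔼 (λ _ → 0ℚ)                  ≡⟨ 𝔼-cong (λ _ → *-zeroˡ 0ℚ) ⟨
    𝔼 (λ _ → 0ℚ * 0ℚ)             ≡⟨ 𝔼-*ˡ 0ℚ (λ _ → 0ℚ) ⟩
    0ℚ * 𝔼 (λ _ → 0ℚ)             ≡⟨ *-zeroˡ (𝔼 (λ _ → 0ℚ)) ⟩
    0ℚ                            ∎
    where open ≡-Reasoning

PrGen-nonNeg : ∀ {n Q} (V : QueryGen n Q) ys → 0ℚ ≤ PrGen V ys
PrGen-nonNeg V ys = avg-nonNeg (R V) (λ r → 𝟙-nonNeg (eqQ (gen V r) ys))

PrGen-concatGen : ∀ {n Q₁ Q₂} (V : QueryGen n Q₁) (U : QueryGen n Q₂) y₁ y₂ →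
                  PrGen (concatGen V U) (y₁ ++ y₂) ≡ PrGen V y₁ * PrGen U y₂
PrGen-concatGen V U y₁ y₂ = trans
  (avg-cong (R V ⊗ R U) λ r →
    𝟙-eqQ-++ (gen V (proj₁ (pair {R V} {R U} r))) y₁ (gen U (proj₂ (pair {R V} {R U} r))) y₂)
  (avg-pair-* (R V) (R U) (λ a → 𝟙 (eqQ (gen V a) y₁)) (λ b → 𝟙 (eqQ (gen U b) y₂)))

Embedding : ℕ → ℕ → ℕ → Set
Embedding n Q k = Str n → Fin (suc k) → Fin Q × Vec (Str n) Q

Event : ℕ → ℕ → Set
Event n Q = Str n → Fin Q → Vec (Str n) Q → Bool

outputAt : ∀ {n Q} → (Fin Q → Bool) → Vec (Str n) Q → Event n Q
outputAt I ys _ i ys′ = I i ∧ eqQ ys′ ys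

module _ {n Q : ℕ} (D : Dist n) where

  PrEmb-cong : ∀ {k} (e : Embedding n Q k) {E F : Event n Q} →
               (∀ w i ys → E w i ys ≡ F w i ys) → PrEmb D k e E ≡ PrEmb D k e F
  PrEmb-cong {k} e E≗F = 𝔼-cong D (λ w → avg-cong k (λ r → cong 𝟙 (E≗F w _ _)))

  PrEmb-outputAt-cong : ∀ {k} (e : Embedding n Q k) {I J : Fin Q → Bool} ys →
                        (∀ i → I i ≡ J i) → PrEmb D k e (outputAt I ys) ≡ PrEmb D k e (outputAt J ys)
  PrEmb-outputAt-cong e ys I≗J = PrEmb-cong e (λ _ i ys′ → cong (_∧ eqQ ys′ ys) (I≗J i))

  PrEmb-never : ∀ {k} (e : Embedding n Q k) → PrEmb D k e (λ _ _ _ → false) ≡ 0ℚ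
  PrEmb-never {k} e = trans (𝔼-cong D (λ _ → avg-const k 0ℚ)) (𝔼-zero D)

  PrEmb-mixture : ∀ p q {k₁ k₂} (e₁ : Embedding n Q k₁) (e₂ : Embedding n Q k₂) (E : Event n Q) →
                  toℚ (suc p ℕ.+ q) * PrEmb D ((p ℕ.+ q) ⊗ (k₁ ⊗ k₂)) (λ w → mixture p q (e₁ w) (e₂ w)) E
                    ≡ toℚ (suc p) * PrEmb D k₁ e₁ E + toℚ q * PrEmb D k₂ e₂ E
  PrEmb-mixture p q {k₁} {k₂} e₁ e₂ E = begin
    toℚ (suc p ℕ.+ q) * 𝔼 D (λ w → avg _ (occurs w ∘ mixture p q (e₁ w) (e₂ w)))
      ≡⟨ 𝔼-*ˡ D (toℚ (suc p ℕ.+ q)) (λ w → avg _ (occurs w ∘ mixture p q (e₁ w) (e₂ w))) ⟨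
    𝔼 D (λ w → toℚ (suc p ℕ.+ q) * avg _ (occurs w ∘ mixture p q (e₁ w) (e₂ w)))
      ≡⟨ 𝔼-cong D (λ w → avg-mixture p q (occurs w) (e₁ w) (e₂ w)) ⟩
    𝔼 D (λ w → toℚ (suc p) * avg k₁ (occurs w ∘ e₁ w) + toℚ q * avg k₂ (occurs w ∘ e₂ w))
      ≡⟨ 𝔼-+ D (λ w → toℚ (suc p) * avg k₁ (occurs w ∘ e₁ w)) (λ w → toℚ q * avg k₂ (occurs w ∘ e₂ w)) ⟩
    𝔼 D (λ w → toℚ (suc p) * avg k₁ (occurs w ∘ e₁ w)) + 𝔼 D (λ w → toℚ q * avg k₂ (occurs w ∘ e₂ w))
      ≡⟨ cong₂ _+_ (𝔼-*ˡ D (toℚ (suc p)) (λ w → avg k₁ (occurs w ∘ e₁ w)))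
                   (𝔼-*ˡ D (toℚ q) (λ w → avg k₂ (occurs w ∘ e₂ w))) ⟩
    toℚ (suc p) * PrEmb D k₁ e₁ E + toℚ q * PrEmb D k₂ e₂ E
      ∎
    where
    open ≡-Reasoning
    occurs : Str n → Fin Q × Vec (Str n) Q → ℚ
    occurs w = 𝟙 ∘ uncurry (E w)

embedLeft : ∀ {n Q₁ Q₂ k} → Embedding n Q₁ k → (U : QueryGen n Q₂) → Embedding n (Q₁ ℕ.+ Q₂) (k ⊗ R U)
embedLeft {Q₂ = Q₂} e U w r = let (a , b) = pair r ; (i , ys) = e w a in i ↑ˡ Q₂ , ys ++ gen U b

embedRight : ∀ {n Q₁ Q₂ k} → (V : QueryGen n Q₁) → Embedding n Q₂ k → Embedding n (Q₁ ℕ.+ Q₂) (R V ⊗ k)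
embedRight {Q₁ = Q₁} V e w r = let (a , b) = pair r ; (i , ys) = e w b in Q₁ ↑ʳ i , gen V a ++ ys

module _ {n Q₁ Q₂ : ℕ} (D : Dist n) where

  PrEmb-embedLeft : ∀ {k} (e : Embedding n Q₁ k) (U : QueryGen n Q₂) I y₁ y₂ →
                    PrEmb D (k ⊗ R U) (embedLeft e U) (outputAt I (y₁ ++ y₂))
                      ≡ PrEmb D k e (outputAt (I ∘ (_↑ˡ Q₂)) y₁) * PrGen U y₂
  PrEmb-embedLeft {k} e U I y₁ y₂ = begin
    𝔼 D (λ w → avg (k ⊗ R U) (λ r → 𝟙 (I (i w (a r) ↑ˡ Q₂) ∧ eqQ (ys w (a r) ++ gen U (b r)) (y₁ ++ y₂))))
      ≡⟨ 𝔼-cong D (λ w → avg-cong (k ⊗ R U) (λ r → split (I (i w (a r) ↑ˡ Q₂)) (ys w (a r)) (gen U (b r)))) ⟩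
    𝔼 D (λ w → avg (k ⊗ R U) (λ r → 𝟙 (A w (a r)) * 𝟙 (eqQ (gen U (b r)) y₂)))
      ≡⟨ 𝔼-cong D (λ w → avg-pair-* k (R U) (𝟙 ∘ A w) (λ b → 𝟙 (eqQ (gen U b) y₂))) ⟩
    𝔼 D (λ w → avg k (𝟙 ∘ A w) * PrGen U y₂)
      ≡⟨ 𝔼-*ʳ D (PrGen U y₂) (λ w → avg k (𝟙 ∘ A w)) ⟩
    PrEmb D k e (outputAt (I ∘ (_↑ˡ Q₂)) y₁) * PrGen U y₂
      ∎
    where
    open ≡-Reasoning
    a : Fin (suc (k ⊗ R U)) → Fin (suc k)
    a r = proj₁ (pair {k} {R U} r)
    b : Fin (suc (k ⊗ R U)) → Fin (suc (R U))
    b r = proj₂ (pair {k} {R U} r)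
    i : Str n → Fin (suc k) → Fin Q₁
    i w = proj₁ ∘ e w
    ys : Str n → Fin (suc k) → Vec (Str n) Q₁
    ys w = proj₂ ∘ e w
    A : Str n → Fin (suc k) → Bool
    A w a = I (i w a ↑ˡ Q₂) ∧ eqQ (ys w a) y₁
    split : ∀ c xs zs → 𝟙 (c ∧ eqQ (xs ++ zs) (y₁ ++ y₂)) ≡ 𝟙 (c ∧ eqQ xs y₁) * 𝟙 (eqQ zs y₂)
    split true  xs zs = 𝟙-eqQ-++ xs y₁ zs y₂
    split false xs zs = sym (*-zeroˡ (𝟙 (eqQ zs y₂)))

  PrEmb-embedRight : ∀ {k} (V : QueryGen n Q₁) (e : Embedding n Q₂ k) I y₁ y₂ →
                     PrEmb D (R V ⊗ k) (embedRight V e) (outputAt I (y₁ ++ y₂))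
                       ≡ PrGen V y₁ * PrEmb D k e (outputAt (I ∘ (Q₁ ↑ʳ_)) y₂)
  PrEmb-embedRight {k} V e I y₁ y₂ = begin
    𝔼 D (λ w → avg (R V ⊗ k) (λ r → 𝟙 (I (Q₁ ↑ʳ i w (b r)) ∧ eqQ (gen V (a r) ++ ys w (b r)) (y₁ ++ y₂))))
      ≡⟨ 𝔼-cong D (λ w → avg-cong (R V ⊗ k) (λ r → split (I (Q₁ ↑ʳ i w (b r))) (gen V (a r)) (ys w (b r)))) ⟩
    𝔼 D (λ w → avg (R V ⊗ k) (λ r → 𝟙 (eqQ (gen V (a r)) y₁) * 𝟙 (B w (b r))))
      ≡⟨ 𝔼-cong D (λ w → avg-pair-* (R V) k (λ a → 𝟙 (eqQ (gen V a) y₁)) (𝟙 ∘ B w)) ⟩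
    𝔼 D (λ w → PrGen V y₁ * avg k (𝟙 ∘ B w))
      ≡⟨ 𝔼-*ˡ D (PrGen V y₁) (λ w → avg k (𝟙 ∘ B w)) ⟩
    PrGen V y₁ * PrEmb D k e (outputAt (I ∘ (Q₁ ↑ʳ_)) y₂)
      ∎
    where
    open ≡-Reasoning
    a : Fin (suc (R V ⊗ k)) → Fin (suc (R V))
    a r = proj₁ (pair {R V} {k} r)
    b : Fin (suc (R V ⊗ k)) → Fin (suc k)
    b r = proj₂ (pair {R V} {k} r)
    i : Str n → Fin (suc k) → Fin Q₂
    i w = proj₁ ∘ e w
    ys : Str n → Fin (suc k) → Vec (Str n) Q₂
    ys w = proj₂ ∘ e w
    B : Str n → Fin (suc k) → Bool
    B w b = I (Q₁ ↑ʳ i w b) ∧ eqQ (ys w b) y₂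
    split : ∀ c xs zs → 𝟙 (c ∧ eqQ (xs ++ zs) (y₁ ++ y₂)) ≡ 𝟙 (eqQ xs y₁) * 𝟙 (c ∧ eqQ zs y₂)
    split true  xs zs = 𝟙-eqQ-++ xs y₁ zs y₂
    split false xs zs = sym (*-zeroʳ (𝟙 (eqQ xs y₁)))

Embeds : ∀ {n Q} → Str n → Fin Q × Vec (Str n) Q → Set
Embeds w (i , ys) = lookup ys i ≡ w

mixture-preserves : ∀ {X : Set} (P : X → Set) p q {k₁ k₂} {f : Fin (suc k₁) → X} {g : Fin (suc k₂) → X} →
                    (∀ r → P (f r)) → (∀ r → P (g r)) → ∀ r → P (mixture p q f g r)
mixture-preserves P p q {k₁} {k₂} {f} {g} Pf Pg r =
  let (c , s) = pair {p ℕ.+ q} {k₁ ⊗ k₂} r in select-preserves (splitAt (suc p) c) s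
  where
  select-preserves : ∀ b s → P (select f g b s)
  select-preserves (inj₁ _) s = Pf _
  select-preserves (inj₂ _) s = Pg _

embedLeft-embeds : ∀ {n Q₁ Q₂ k} (e : Embedding n Q₁ k) (U : QueryGen n Q₂) w →
                   (∀ a → Embeds w (e w a)) → ∀ r → Embeds w (embedLeft e U w r)
embedLeft-embeds {Q₂ = Q₂} {k} e U w embeds r =
  let (a , b) = pair {k} {R U} r in trans (lookup-++ˡ (proj₂ (e w a)) (gen U b) (proj₁ (e w a))) (embeds a)

embedRight-embeds : ∀ {n Q₁ Q₂ k} (V : QueryGen n Q₁) (e : Embedding n Q₂ k) w →
                    (∀ b → Embeds w (e w b)) → ∀ r → Embeds w (embedRight V e w r)
embedRight-embeds {k = k} V e w embeds r =
  let (a , b) = pair {R V} {k} r in trans (lookup-++ʳ (gen V a) (proj₂ (e w b)) (proj₁ (e w b))) (embeds b)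

module Concatenation {n q₁ Q₂ : ℕ} {D : Dist n} {V : QueryGen n (suc q₁)} {U : QueryGen n Q₂}
                     (EV : Embeddable D V) (EU : Embeddable D U) where

  open Embeddable

  Q₁ : ℕ
  Q₁ = suc q₁

  R'ᵀ : ℕ
  R'ᵀ = (q₁ ℕ.+ Q₂) ⊗ ((R' EV ⊗ R U) ⊗ (R V ⊗ R' EU))

  embᵀ : Embedding n (Q₁ ℕ.+ Q₂) R'ᵀ
  embᵀ w = mixture q₁ Q₂ (embedLeft (emb EV) U w) (embedRight V (emb EU) w)

  PrEmbᵀ-outputAt : ∀ I y₁ y₂ →
    toℚ (Q₁ ℕ.+ Q₂) * PrEmb D R'ᵀ embᵀ (outputAt I (y₁ ++ y₂))
      ≡ toℚ Q₁ * (PrEmb D (R' EV) (emb EV) (outputAt (I ∘ (_↑ˡ Q₂)) y₁) * PrGen U y₂)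
        + toℚ Q₂ * (PrGen V y₁ * PrEmb D (R' EU) (emb EU) (outputAt (I ∘ (Q₁ ↑ʳ_)) y₂))
  PrEmbᵀ-outputAt I y₁ y₂ = trans
    (PrEmb-mixture D q₁ Q₂ (embedLeft (emb EV) U) (embedRight V (emb EU)) (outputAt I (y₁ ++ y₂)))
    (cong₂ (λ x y → toℚ Q₁ * x + toℚ Q₂ * y)
      (PrEmb-embedLeft D (emb EV) U I y₁ y₂) (PrEmb-embedRight D V (emb EU) I y₁ y₂))

  sameDistᵀ-++ : ∀ y₁ y₂ → PrEmb D R'ᵀ embᵀ (outputAt (λ _ → true) (y₁ ++ y₂)) ≡ PrGen V y₁ * PrGen U y₂
  sameDistᵀ-++ y₁ y₂ = toℚ-cancelˡ (q₁ ℕ.+ Q₂) (begin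
    toℚ (Q₁ ℕ.+ Q₂) * PrEmb D R'ᵀ embᵀ (outputAt (λ _ → true) (y₁ ++ y₂))
      ≡⟨ PrEmbᵀ-outputAt (λ _ → true) y₁ y₂ ⟩
    toℚ Q₁ * (PrEmb D (R' EV) (emb EV) (outputAt (λ _ → true) y₁) * PrGen U y₂)
      + toℚ Q₂ * (PrGen V y₁ * PrEmb D (R' EU) (emb EU) (outputAt (λ _ → true) y₂))
      ≡⟨ cong₂ (λ x y → toℚ Q₁ * (x * PrGen U y₂) + toℚ Q₂ * (PrGen V y₁ * y))
               (sameDist EV y₁) (sameDist EU y₂) ⟩
    toℚ Q₁ * (PrGen V y₁ * PrGen U y₂) + toℚ Q₂ * (PrGen V y₁ * PrGen U y₂)
      ≡⟨ *-distribʳ-+ (PrGen V y₁ * PrGen U y₂) (toℚ Q₁) (toℚ Q₂) ⟨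
    (toℚ Q₁ + toℚ Q₂) * (PrGen V y₁ * PrGen U y₂)
      ≡⟨ cong (_* (PrGen V y₁ * PrGen U y₂)) (toℚ-+ Q₁ Q₂) ⟨
    toℚ (Q₁ ℕ.+ Q₂) * (PrGen V y₁ * PrGen U y₂)
      ∎)
    where open ≡-Reasoning

  IndexUniformAt : Vec (Str n) Q₁ → Vec (Str n) Q₂ → Fin (Q₁ ℕ.+ Q₂) → Set
  IndexUniformAt y₁ y₂ j =
    toℚ (Q₁ ℕ.+ Q₂) * PrEmb D R'ᵀ embᵀ (outputAt (λ i → eqFin i j) (y₁ ++ y₂)) ≡ PrGen V y₁ * PrGen U y₂

  uniformIndexᵀ-↑ˡ : ∀ y₁ y₂ → 0ℚ < PrGen V y₁ * PrGen U y₂ → ∀ j₁ → IndexUniformAt y₁ y₂ (j₁ ↑ˡ Q₂)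
  uniformIndexᵀ-↑ˡ y₁ y₂ pos j₁ = begin
    toℚ (Q₁ ℕ.+ Q₂) * PrEmb D R'ᵀ embᵀ (outputAt (λ i → eqFin i (j₁ ↑ˡ Q₂)) (y₁ ++ y₂))
      ≡⟨ PrEmbᵀ-outputAt (λ i → eqFin i (j₁ ↑ˡ Q₂)) y₁ y₂ ⟩
    toℚ Q₁ * (PrEmb D (R' EV) (emb EV) (outputAt (λ i → eqFin (i ↑ˡ Q₂) (j₁ ↑ˡ Q₂)) y₁) * PU)
      + toℚ Q₂ * (PV * PrEmb D (R' EU) (emb EU) (outputAt (λ i → eqFin (Q₁ ↑ʳ i) (j₁ ↑ˡ Q₂)) y₂))
      ≡⟨ cong₂ (λ x y → toℚ Q₁ * (x * PU) + toℚ Q₂ * (PV * y))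
           (PrEmb-outputAt-cong D (emb EV) y₁ (λ i → eqFin-↑ˡ Q₂ i j₁))
           (trans (PrEmb-outputAt-cong D (emb EU) y₂ (λ i → eqFin-↑ʳ-↑ˡ i j₁)) (PrEmb-never D (emb EU))) ⟩
    toℚ Q₁ * (PrEmb D (R' EV) (emb EV) (outputAt (λ i → eqFin i j₁) y₁) * PU) + toℚ Q₂ * (PV * 0ℚ)
      ≡⟨ solve 5 (λ a b x u v → a :* (x :* u) :+ b :* (v :* con 0ℚ) := (a :* x) :* u) refl
           (toℚ Q₁) (toℚ Q₂) (PrEmb D (R' EV) (emb EV) (outputAt (λ i → eqFin i j₁) y₁)) PU PV ⟩
    toℚ Q₁ * PrEmb D (R' EV) (emb EV) (outputAt (λ i → eqFin i j₁) y₁) * PU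
      ≡⟨ cong (_* PU) (trans (uniformIndex EV y₁ (*-positiveˡ (PrGen-nonNeg V y₁) pos) j₁) (sameDist EV y₁)) ⟩
    PV * PU
      ∎
    where
    open ≡-Reasoning
    PV PU : ℚ
    PV = PrGen V y₁
    PU = PrGen U y₂

  uniformIndexᵀ-↑ʳ : ∀ y₁ y₂ → 0ℚ < PrGen V y₁ * PrGen U y₂ → ∀ j₂ → IndexUniformAt y₁ y₂ (Q₁ ↑ʳ j₂)
  uniformIndexᵀ-↑ʳ y₁ y₂ pos j₂ = begin
    toℚ (Q₁ ℕ.+ Q₂) * PrEmb D R'ᵀ embᵀ (outputAt (λ i → eqFin i (Q₁ ↑ʳ j₂)) (y₁ ++ y₂))
      ≡⟨ PrEmbᵀ-outputAt (λ i → eqFin i (Q₁ ↑ʳ j₂)) y₁ y₂ ⟩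
    toℚ Q₁ * (PrEmb D (R' EV) (emb EV) (outputAt (λ i → eqFin (i ↑ˡ Q₂) (Q₁ ↑ʳ j₂)) y₁) * PU)
      + toℚ Q₂ * (PV * PrEmb D (R' EU) (emb EU) (outputAt (λ i → eqFin (Q₁ ↑ʳ i) (Q₁ ↑ʳ j₂)) y₂))
      ≡⟨ cong₂ (λ x y → toℚ Q₁ * (x * PU) + toℚ Q₂ * (PV * y))
           (trans (PrEmb-outputAt-cong D (emb EV) y₁ (λ i → eqFin-↑ˡ-↑ʳ i j₂)) (PrEmb-never D (emb EV)))
           (PrEmb-outputAt-cong D (emb EU) y₂ (λ i → eqFin-↑ʳ Q₁ i j₂)) ⟩
    toℚ Q₁ * (0ℚ * PU) + toℚ Q₂ * (PV * PrEmb D (R' EU) (emb EU) (outputAt (λ i → eqFin i j₂) y₂))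
      ≡⟨ solve 5 (λ a b x u v → a :* (con 0ℚ :* u) :+ b :* (v :* x) := v :* (b :* x)) refl
           (toℚ Q₁) (toℚ Q₂) (PrEmb D (R' EU) (emb EU) (outputAt (λ i → eqFin i j₂) y₂)) PU PV ⟩
    PV * (toℚ Q₂ * PrEmb D (R' EU) (emb EU) (outputAt (λ i → eqFin i j₂) y₂))
      ≡⟨ cong (PV *_) (trans (uniformIndex EU y₂ (*-positiveʳ {PV} (PrGen-nonNeg U y₂) pos) j₂) (sameDist EU y₂)) ⟩
    PV * PU
      ∎
    where
    open ≡-Reasoning
    PV PU : ℚ
    PV = PrGen V y₁
    PU = PrGen U y₂

  uniformIndexᵀ-++ : ∀ y₁ y₂ → 0ℚ < PrGen V y₁ * PrGen U y₂ → ∀ j → IndexUniformAt y₁ y₂ j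
  uniformIndexᵀ-++ y₁ y₂ pos j = subst (IndexUniformAt y₁ y₂) (join-splitAt Q₁ Q₂ j) (atBlock (splitAt Q₁ j))
    where
    atBlock : ∀ s → IndexUniformAt y₁ y₂ (join Q₁ Q₂ s)
    atBlock (inj₁ j₁) = uniformIndexᵀ-↑ˡ y₁ y₂ pos j₁
    atBlock (inj₂ j₂) = uniformIndexᵀ-↑ʳ y₁ y₂ pos j₂

  concatenation : Embeddable D (concatGen V U)
  concatenation = record
    { R'           = R'ᵀ
    ; emb          = embᵀ
    ; embeds       = embedsᵀ
    ; uniformIndex = uniformIndexᵀ
    ; sameDist     = sameDistᵀ
    }
    where
    embedsᵀ : ∀ w r → 0ℚ < weight D w → Embeds w (embᵀ w r)
    embedsᵀ w r w∈D = mixture-preserves (Embeds w) q₁ Q₂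
      {f = embedLeft (emb EV) U w} {g = embedRight V (emb EU) w}
      (embedLeft-embeds (emb EV) U w (λ a → embeds EV w a w∈D))
      (embedRight-embeds V (emb EU) w (λ b → embeds EU w b w∈D)) r
    sameDistᵀ : ∀ ys → PrEmb D R'ᵀ embᵀ (λ _ _ ys′ → eqQ ys′ ys) ≡ PrGen (concatGen V U) ys
    sameDistᵀ ys with Vec.splitAt Q₁ ys
    ... | y₁ , y₂ , refl = trans (sameDistᵀ-++ y₁ y₂) (sym (PrGen-concatGen V U y₁ y₂))
    uniformIndexᵀ : ∀ ys → 0ℚ < PrGen (concatGen V U) ys → ∀ j →
      toℚ (Q₁ ℕ.+ Q₂) * PrEmb D R'ᵀ embᵀ (λ _ i ys′ → eqFin i j ∧ eqQ ys′ ys)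
        ≡ PrEmb D R'ᵀ embᵀ (λ _ _ ys′ → eqQ ys′ ys)
    uniformIndexᵀ ys pos j with Vec.splitAt Q₁ ys
    ... | y₁ , y₂ , refl = trans
      (uniformIndexᵀ-++ y₁ y₂ (subst (0ℚ <_) (PrGen-concatGen V U y₁ y₂) pos) j)
      (sym (sameDistᵀ-++ y₁ y₂))

propositionA2 : {n Q₁ Q₂ : ℕ} (D : Dist n) (V : QueryGen n Q₁) (U : QueryGen n Q₂)
    → Embeddable D V → Embeddable D U → Embeddable D (concatGen V U)
propositionA2 {n} {zero}  D V U EV EU =
  contradiction (proj₁ (Embeddable.emb EV (Vec.replicate n false) Fin.zero)) ¬Fin0
propositionA2 {n} {suc _} D V U EV EU = Concatenation.concatenation EV EU
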